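{- Let $G$ be a connected graph on $q\ge 2$ vertices. For every $n\in\mathbb{N}$, the metric dimension $m(G,n)$ of $G^{\square n}$ satisfies \[ m(G,n) \ge \left(2 - O\!\left(\frac{\log\log n}{\log n}\right)\right)\frac{n}{\log_q n}. \]
   Context: A set of vertices $S$ resolves a graph $H$ if every vertex of $H$ is uniquely determined by its vector of distances to the vertices in $S$; the metric dimension of $H$ is the minimum cardinality of a resolving set. The Cartesian product of graphs $G_1,\dots,G_n$ has vertex set $V(G_1)\times\dots\times V(G_n)$, with $(u_1,\dots,u_n)$ and $(v_1,\dots,v_n)$ adjacent iff there is $j$ with $u_i=v_i$ for all $i\ne j$ and $u_j$ adjacent to $v_j$ in $G_j$. $G^{\square n}$ denotes the Cartesian product of $n$ copies of $G$, and $m(G,n)$ its metric dimension. The $O(\cdot)$ term is as $n\to\infty$ with $G$ fixed. -}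

module Defs where

open import Data.Nat using (ℕ; zero; suc; _+_; _*_; _^_; _≤_; _<_)
open import Data.Fin using (Fin)
open import Data.Vec using (Vec; lookup)
open import Data.List using (List; length)
open import Data.List.Membership.Propositional using (_∈_)
open import Data.List.Relation.Unary.Unique.Propositional using (Unique)
open import Data.Product using (Σ; ∃; _×_; _,_)
open import Relation.Nullary using (¬_)
open import Relation.Binary.PropositionalEquality using (_≡_; _≢_)

record Graph (q : ℕ) : Set₁ where
  field
    Adj   : Fin q → Fin q → Set
    irrefl : ∀ u → ¬ Adj u u
    sym    : ∀ {u v} → Adj u v → Adj v u
open Graph public

data Walk {V : Set} (E : V → V → Set) : V → V → ℕ → Set where
  here : ∀ {u} → Walk E u u zero
  step : ∀ {u w v k} → E u w → Walk E w v k → Walk E u v (suc k)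

Dist : {V : Set} → (V → V → Set) → V → V → ℕ → Set
Dist E u v k = Walk E u v k × (∀ j → j < k → ¬ Walk E u v j)

Connected : ∀ {q} → Graph q → Set
Connected G = ∀ u v → ∃ λ k → Walk (Adj G) u v k

Resolves : {V : Set} → (V → V → Set) → List V → Set
Resolves {V} E S = ∀ (x y : V) →
  (∀ s → s ∈ S → ∀ k → (Dist E s x k → Dist E s y k) × (Dist E s y k → Dist E s x k)) →
  x ≡ y

IsMetricDimension : {V : Set} → (V → V → Set) → ℕ → Set
IsMetricDimension {V} E m =
  (Σ (List V) λ S → Unique S × Resolves E S × length S ≡ m) ×
  (∀ (S : List V) → Unique S → Resolves E S → m ≤ length S)

PowAdj : ∀ {q} → Graph q → (n : ℕ) → Vec (Fin q) n → Vec (Fin q) n → Set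
PowAdj G n u v = Σ (Fin n) λ j →
  Adj G (lookup u j) (lookup v j) × (∀ i → i ≢ j → lookup u i ≡ lookup v i)

FloorLog : ℕ → ℕ → ℕ → Set
FloorLog b n k = b ^ k ≤ n × n < b ^ suc k

-- Let S be a resolving set of size m in G^□n and d the distance of G, bounded by D. The profile
-- x ↦ (d(s, x))_{s ∈ S} is injective on the qⁿ vertices, and d(s, x) = Σᵢ d(sᵢ, xᵢ) is a sum of n
-- functions of independent coordinates, so its variance over x is at most n D² and the average of
-- ∣d(s, x) − d(s, y)∣ over pairs is O(D √n). By Markov's inequality half of all pairs have profiles
-- within ℓ₁-distance O(m D √n), while such an ℓ₁-ball in ℕᵐ holds only O(D √n)ᵐ points. Hence
-- qⁿ ≤ 2 O(D √n)ᵐ, i.e. 2n ≤ m (⌊log_q n⌋ + O(1)). This is stronger than the stated bound, whose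
-- ℓ and λ′ enter only through ℓ ≤ n, ℓ < q (k + 1) and λ′ ≥ 1.

module Submission where

open import Defs hiding (sym)
open import Data.Nat
open import Data.Nat.Properties
open import Data.Nat.Induction using (<-rec)
open import Algebra.Properties.CommutativeSemigroup +-commutativeSemigroup
  using (xy∙z≈xz∙y; x∙yz≈y∙xz) renaming (interchange to +-interchange)
open import Algebra.Properties.CommutativeSemigroup *-commutativeSemigroup
  using () renaming (interchange to *-interchange)
open import Data.Nat.Tactic.RingSolver using (solve-∀)
open import Data.Fin using (Fin; zero; suc)
open import Data.Vec using (Vec; []; _∷_)
open import Data.Vec.Properties using (∷-injective; tabulate∘lookup; tabulate-cong)
open import Data.List using (List; []; _∷_; _++_; map; length; filter; zipWith; concatMap; upTo; allFin; cartesianProductWith)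
open import Data.Nat.ListAction using (sum)
open import Data.List.Properties using (length-++; length-map; length-tabulate; map-upTo; ∷-injectiveˡ; ∷-injectiveʳ)
open import Data.List.Membership.Propositional using (_∈_; lose)
open import Data.List.Membership.Propositional.Properties
  using ( ∈-∃++; ∈-++⁻; ∈-++⁺ˡ; ∈-++⁺ʳ; ∈-map⁺; ∈-map⁻; ∈-filter⁻; ∈-concatMap⁺
        ; ∈-upTo⁺; ∈-upTo⁻; ∈-allFin)
open import Data.List.Relation.Binary.Subset.Propositional using (_⊆_)
open import Data.List.Relation.Unary.Any using (here; there)
import Data.List.Relation.Unary.All as All
open import Data.List.Relation.Unary.AllPairs using ([]; _∷_)
open import Data.List.Relation.Unary.Unique.Propositional using (Unique)
open import Data.List.Relation.Unary.Unique.Propositional.Properties using (allFin⁺; cartesianProductWith⁺; map⁺; filter⁺)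
open import Data.Product using (Σ; ∃₂; ∃-syntax; _×_; _,_; proj₁; proj₂)
open import Data.Sum using (_⊎_; inj₁; inj₂)
open import Data.Empty using (⊥-elim)
open import Relation.Nullary using (¬_; yes; no; contradiction; ¬¬-map)
open import Relation.Nullary.Decidable using (¬¬-excluded-middle; decidable-stable)
open import Function using (id)
open import Relation.Unary using (Decidable)
open import Relation.Binary.PropositionalEquality

private variable A B C : Set

∑ : List A → (A → ℕ) → ℕ
∑ xs f = sum (map f xs)

syntax ∑ xs (λ x → e) = ∑[ x ← xs ] e

∑-cong : ∀ (xs : List A) {f g : A → ℕ} → (∀ x → f x ≡ g x) → ∑ xs f ≡ ∑ xs g
∑-cong []       f≗g = refl
∑-cong (x ∷ xs) f≗g = cong₂ _+_ (f≗g x) (∑-cong xs f≗g)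

∑-mono-≤ : ∀ (xs : List A) {f g : A → ℕ} → (∀ x → x ∈ xs → f x ≤ g x) → ∑ xs f ≤ ∑ xs g
∑-mono-≤ []       f≤g = z≤n
∑-mono-≤ (x ∷ xs) f≤g = +-mono-≤ (f≤g x (here refl)) (∑-mono-≤ xs (λ y y∈xs → f≤g y (there y∈xs)))

∑-distrib-+ : ∀ (xs : List A) (f g : A → ℕ) → ∑[ x ← xs ] (f x + g x) ≡ ∑ xs f + ∑ xs g
∑-distrib-+ []       f g = refl
∑-distrib-+ (x ∷ xs) f g rewrite ∑-distrib-+ xs f g = +-interchange (f x) (g x) (∑ xs f) (∑ xs g)

∑-*ˡ : ∀ (xs : List A) c (f : A → ℕ) → ∑[ x ← xs ] (c * f x) ≡ c * ∑ xs f
∑-*ˡ []       c f = sym (*-zeroʳ c)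
∑-*ˡ (x ∷ xs) c f rewrite ∑-*ˡ xs c f = sym (*-distribˡ-+ c (f x) (∑ xs f))

∑-*ʳ : ∀ (xs : List A) c (f : A → ℕ) → ∑[ x ← xs ] (f x * c) ≡ ∑ xs f * c
∑-*ʳ []       c f = refl
∑-*ʳ (x ∷ xs) c f rewrite ∑-*ʳ xs c f = sym (*-distribʳ-+ c (f x) (∑ xs f))

∑-const : ∀ (xs : List A) c → ∑[ _ ← xs ] c ≡ length xs * c
∑-const []       c = refl
∑-const (x ∷ xs) c = cong (c +_) (∑-const xs c)

∑-++ : ∀ (xs ys : List A) (f : A → ℕ) → ∑ (xs ++ ys) f ≡ ∑ xs f + ∑ ys f
∑-++ []       ys f = refl
∑-++ (x ∷ xs) ys f rewrite ∑-++ xs ys f = sym (+-assoc (f x) (∑ xs f) (∑ ys f))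

∈⇒≤∑ : ∀ {xs : List A} {x} (f : A → ℕ) → x ∈ xs → f x ≤ ∑ xs f
∈⇒≤∑ f (here refl) = m≤m+n _ _
∈⇒≤∑ {xs = y ∷ _} f (there x∈xs) = ≤-trans (∈⇒≤∑ f x∈xs) (m≤n+m _ (f y))

∑-map : ∀ (xs : List A) (h : A → B) (f : B → ℕ) → ∑ (map h xs) f ≡ ∑[ x ← xs ] f (h x)
∑-map []       h f = refl
∑-map (x ∷ xs) h f = cong (f (h x) +_) (∑-map xs h f)

∑-comm : ∀ (xs : List A) (ys : List B) (F : A → B → ℕ) →
         ∑[ x ← xs ] ∑[ y ← ys ] F x y ≡ ∑[ y ← ys ] ∑[ x ← xs ] F x y
∑-comm []       ys F = sym (trans (∑-const ys 0) (*-zeroʳ (length ys)))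
∑-comm (x ∷ xs) ys F rewrite ∑-comm xs ys F = sym (∑-distrib-+ ys (F x) (λ y → ∑[ x ← xs ] F x y))

∑-*-∑ : ∀ (xs : List A) (ys : List B) (f : A → ℕ) (g : B → ℕ) →
        ∑[ x ← xs ] ∑[ y ← ys ] (f x * g y) ≡ ∑ xs f * ∑ ys g
∑-*-∑ xs ys f g = trans (∑-cong xs (λ x → ∑-*ˡ ys (f x) g)) (∑-*ʳ xs (∑ ys g) f)

∑-cartesianProductWith : ∀ (h : A → B → C) (xs : List A) (ys : List B) (F : C → ℕ) →
  ∑ (cartesianProductWith h xs ys) F ≡ ∑[ x ← xs ] ∑[ y ← ys ] F (h x y)
∑-cartesianProductWith h []       ys F = refl
∑-cartesianProductWith h (x ∷ xs) ys F = trans (∑-++ (map (h x) ys) _ F)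
  (cong₂ _+_ (∑-map ys (h x) F) (∑-cartesianProductWith h xs ys F))

length-cartesianProductWith : ∀ (h : A → B → C) (xs : List A) (ys : List B) →
  length (cartesianProductWith h xs ys) ≡ length xs * length ys
length-cartesianProductWith h []       ys = refl
length-cartesianProductWith h (x ∷ xs) ys = begin
  length (map (h x) ys ++ cartesianProductWith h xs ys)
    ≡⟨ length-++ (map (h x) ys) ⟩
  length (map (h x) ys) + length (cartesianProductWith h xs ys)
    ≡⟨ cong₂ _+_ (length-map (h x) ys) (length-cartesianProductWith h xs ys) ⟩
  length ys + length xs * length ys                           ∎
  where open ≡-Reasoning

length-mono-⊆ : ∀ {xs ys : List A} → Unique xs → xs ⊆ ys → length xs ≤ length ys
length-mono-⊆ {xs = []}     _              _  = z≤n
length-mono-⊆ {xs = x ∷ xs} (x∉xs ∷ uniq) xs⊆ys with ∈-∃++ (xs⊆ys (here refl))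
... | ys₁ , ys₂ , refl = begin
  suc (length xs)                ≤⟨ s≤s (length-mono-⊆ uniq xs⊆ys₁++ys₂) ⟩
  suc (length (ys₁ ++ ys₂))       ≡⟨ cong suc (length-++ ys₁) ⟩
  suc (length ys₁ + length ys₂)   ≡⟨ sym (+-suc (length ys₁) (length ys₂)) ⟩
  length ys₁ + length (x ∷ ys₂)   ≡⟨ sym (length-++ ys₁) ⟩
  length (ys₁ ++ x ∷ ys₂)         ∎
  where
  open ≤-Reasoning
  xs⊆ys₁++ys₂ : xs ⊆ ys₁ ++ ys₂
  xs⊆ys₁++ys₂ z∈xs with ∈-++⁻ ys₁ (xs⊆ys (there z∈xs))
  ... | inj₁ z∈ys₁         = ∈-++⁺ˡ z∈ys₁
  ... | inj₂ (here refl)   = ⊥-elim (All.lookup x∉xs z∈xs refl)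
  ... | inj₂ (there z∈ys₂) = ∈-++⁺ʳ ys₁ z∈ys₂

m≤n⇒m²+n²≡2mn+∣m-n∣² : ∀ {m n} → m ≤ n → m * m + n * n ≡ 2 * (m * n) + ∣ m - n ∣ * ∣ m - n ∣
m≤n⇒m²+n²≡2mn+∣m-n∣² {m} m≤n with d , refl ← m≤n⇒∃[o]m+o≡n m≤n
  rewrite ∣m-m+n∣≡n m d = identity m d
  where
  identity : ∀ m d → m * m + (m + d) * (m + d) ≡ 2 * (m * (m + d)) + d * d
  identity = solve-∀

m²+n²≡2mn+∣m-n∣² : ∀ m n → m * m + n * n ≡ 2 * (m * n) + ∣ m - n ∣ * ∣ m - n ∣
m²+n²≡2mn+∣m-n∣² m n with ≤-total m n
... | inj₁ m≤n = m≤n⇒m²+n²≡2mn+∣m-n∣² m≤n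
... | inj₂ n≤m = begin
  m * m + n * n                       ≡⟨ +-comm (m * m) (n * n) ⟩
  n * n + m * m                       ≡⟨ m≤n⇒m²+n²≡2mn+∣m-n∣² n≤m ⟩
  2 * (n * m) + ∣ n - m ∣ * ∣ n - m ∣ ≡⟨ cong₂ (λ a b → 2 * a + b * b) (*-comm n m) (∣-∣-comm n m) ⟩
  2 * (m * n) + ∣ m - n ∣ * ∣ m - n ∣ ∎
  where open ≡-Reasoning

2mn≤m²+n² : ∀ m n → 2 * (m * n) ≤ m * m + n * n
2mn≤m²+n² m n = subst (2 * (m * n) ≤_) (sym (m²+n²≡2mn+∣m-n∣² m n)) (m≤m+n _ _)

m*m≤n*n⇒m≤n : ∀ {m n} → m * m ≤ n * n → m ≤ n
m*m≤n*n⇒m≤n {m} {n} m²≤n² with m ≤? n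
... | yes m≤n = m≤n
... | no  m≰n = contradiction m²≤n² (<⇒≱ (*-mono-< (≰⇒> m≰n) (≰⇒> m≰n)))

cauchy-schwarz : ∀ (xs : List A) (f : A → ℕ) → ∑ xs f * ∑ xs f ≤ length xs * ∑[ x ← xs ] (f x * f x)
cauchy-schwarz []       f = z≤n
cauchy-schwarz (x ∷ xs) f = begin
  (a + F) * (a + F)                 ≡⟨ square-+ a F ⟩
  a * a + 2 * (a * F) + F * F       ≤⟨ +-mono-≤ (+-monoʳ-≤ (a * a) cross) (cauchy-schwarz xs f) ⟩
  a * a + (n * (a * a) + Q) + n * Q ≡⟨ regroup a n Q ⟩
  suc n * (a * a + Q)               ∎
  where
  open ≤-Reasoning
  a = f x
  F = ∑ xs f
  Q = ∑[ y ← xs ] (f y * f y)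
  n = length xs
  cross : 2 * (a * F) ≤ n * (a * a) + Q
  cross = begin
    2 * (a * F)                        ≡⟨ cong (2 *_) (sym (∑-*ˡ xs a f)) ⟩
    2 * ∑[ y ← xs ] (a * f y)          ≡⟨ sym (∑-*ˡ xs 2 _) ⟩
    ∑[ y ← xs ] (2 * (a * f y))        ≤⟨ ∑-mono-≤ xs (λ y _ → 2mn≤m²+n² a (f y)) ⟩
    ∑[ y ← xs ] (a * a + f y * f y)    ≡⟨ ∑-distrib-+ xs _ _ ⟩
    ∑[ _ ← xs ] (a * a) + Q            ≡⟨ cong (_+ Q) (∑-const xs (a * a)) ⟩
    n * (a * a) + Q                    ∎
  square-+ : ∀ a F → (a + F) * (a + F) ≡ a * a + 2 * (a * F) + F * F
  square-+ = solve-∀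
  regroup : ∀ a n Q → a * a + (n * (a * a) + Q) + n * Q ≡ suc n * (a * a + Q)
  regroup = solve-∀

^-distribʳ-* : ∀ m n o → (m * n) ^ o ≡ m ^ o * n ^ o
^-distribʳ-* m n zero    = refl
^-distribʳ-* m n (suc o) rewrite ^-distribʳ-* m n o = *-interchange m n (m ^ o) (n ^ o)

n<2^n : ∀ n → n < 2 ^ n
n<2^n zero    = s≤s z≤n
n<2^n (suc n) = begin-strict
  suc n         <⟨ s≤s (n<2^n n) ⟩
  suc (2 ^ n)   ≤⟨ +-monoˡ-≤ (2 ^ n) (m^n>0 2 n) ⟩
  2 ^ n + 2 ^ n ≡⟨ cong (2 ^ n +_) (sym (+-identityʳ (2 ^ n))) ⟩
  2 ^ suc n     ∎
  where open ≤-Reasoning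

^-cancelˡ-< : ∀ b → 2 ≤ b → ∀ {m n} → b ^ m < b ^ n → m < n
^-cancelˡ-< b@(suc _) 2≤b {m} {n} bᵐ<bⁿ with m <? n
... | yes m<n = m<n
... | no  m≮n = contradiction bᵐ<bⁿ (≤⇒≯ (^-monoʳ-≤ b (≮⇒≥ m≮n)))

bernoulli : ∀ a k → suc a ^ suc k ≤ a ^ suc k + suc k * suc a ^ k
bernoulli a zero    = ≤-reflexive (+-comm 1 (a * 1))
bernoulli a (suc k) = begin
  suc a * suc a ^ suc k                              ≤⟨ *-monoʳ-≤ (suc a) (bernoulli a k) ⟩
  suc a * (P + suc k * Q)                            ≡⟨ expand a P Q k ⟩
  a * P + suc k * (suc a * Q) + P                    ≤⟨ +-monoʳ-≤ _ (^-monoˡ-≤ (suc k) (n≤1+n a)) ⟩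
  a * P + suc k * (suc a * Q) + suc a * Q            ≡⟨ collect a P Q k ⟩
  a * P + suc (suc k) * (suc a * Q)                  ∎
  where
  open ≤-Reasoning
  P = a ^ suc k
  Q = suc a ^ k
  expand : ∀ a P Q k → suc a * (P + suc k * Q) ≡ a * P + suc k * (suc a * Q) + P
  expand = solve-∀
  collect : ∀ a P Q k → a * P + suc k * (suc a * Q) + suc a * Q ≡ a * P + suc (suc k) * (suc a * Q)
  collect = solve-∀

[1+a]^[1+k]≤2a^[1+k] : ∀ a k → 2 * suc k ≤ suc a → suc a ^ suc k ≤ 2 * a ^ suc k
[1+a]^[1+k]≤2a^[1+k] a k 2[1+k]≤1+a = +-cancelʳ-≤ X X (2 * a ^ suc k) (begin
  X + X                                   ≡⟨ double X ⟩
  2 * X                                   ≤⟨ *-monoʳ-≤ 2 (bernoulli a k) ⟩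
  2 * (a ^ suc k + suc k * suc a ^ k)     ≡⟨ *-distribˡ-+ 2 (a ^ suc k) _ ⟩
  2 * a ^ suc k + 2 * (suc k * suc a ^ k) ≡⟨ cong (2 * a ^ suc k +_) (sym (*-assoc 2 (suc k) _)) ⟩
  2 * a ^ suc k + 2 * suc k * suc a ^ k   ≤⟨ +-monoʳ-≤ (2 * a ^ suc k) (*-monoˡ-≤ (suc a ^ k) 2[1+k]≤1+a) ⟩
  2 * a ^ suc k + X                       ∎)
  where
  open ≤-Reasoning
  X = suc a ^ suc k
  double : ∀ x → x + x ≡ 2 * x
  double = solve-∀

-- ℓ₁-balls in ℕᵐ

∑-upTo-suc : ∀ t (f : ℕ → ℕ) → ∑ (upTo (suc t)) f ≡ f 0 + ∑[ j ← upTo t ] f (suc j)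
∑-upTo-suc t f = cong (f 0 +_) (trans (cong (λ js → ∑ js f) (sym (map-upTo suc t))) (∑-map (upTo t) suc f))

∑-geometric : ∀ a t → ∑[ j ← upTo (suc t) ] (a ^ j * suc a ^ (t ∸ j)) ≤ suc a ^ suc t
∑-geometric a zero    = s≤s z≤n
∑-geometric a (suc t) = begin
  ∑[ j ← upTo (suc (suc t)) ] (a ^ j * suc a ^ (suc t ∸ j))
    ≡⟨ ∑-upTo-suc (suc t) (λ j → a ^ j * suc a ^ (suc t ∸ j)) ⟩
  X + ∑[ j ← js ] (a * a ^ j * suc a ^ (t ∸ j))
    ≡⟨ cong (X +_) (trans (∑-cong js (λ j → *-assoc a (a ^ j) _)) (∑-*ˡ js a _)) ⟩
  X + a * ∑[ j ← js ] (a ^ j * suc a ^ (t ∸ j))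
    ≤⟨ +-monoʳ-≤ X (*-monoʳ-≤ a (∑-geometric a t)) ⟩
  1 * suc a ^ suc t + a * suc a ^ suc t
    ≡⟨ sym (*-distribʳ-+ (suc a ^ suc t) 1 a) ⟩
  suc a ^ suc (suc t)
    ∎
  where
  open ≤-Reasoning
  js = upTo (suc t)
  X = 1 * suc a ^ suc t

ℓ₁ : List ℕ → List ℕ → ℕ
ℓ₁ w c = sum (zipWith ∣_-_∣ w c)

ℓ₁-map : ∀ (xs : List A) (f g : A → ℕ) → ℓ₁ (map f xs) (map g xs) ≡ ∑[ x ← xs ] ∣ f x - g x ∣
ℓ₁-map []       f g = refl
ℓ₁-map (x ∷ xs) f g = cong (∣ f x - g x ∣ +_) (ℓ₁-map xs f g)

prepend± : ℕ → ℕ → List (List ℕ) → List (List ℕ)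
prepend± c j ws = map ((c + j) ∷_) ws ++ map ((c ∸ j) ∷_) ws

-- For j > c the entry c ∸ j is truncated to 0, so points may be listed repeatedly.
ball : List ℕ → ℕ → List (List ℕ)
ball []       t = [] ∷ []
ball (c ∷ cs) t = concatMap (λ j → prepend± c j (ball cs (t ∸ j))) (upTo (suc t))

≡+∣-∣⊎≡∸∣-∣ : ∀ w c → w ≡ c + ∣ w - c ∣ ⊎ w ≡ c ∸ ∣ w - c ∣
≡+∣-∣⊎≡∸∣-∣ w c with ≤-total c w
... | inj₁ c≤w = inj₁ (trans (sym (m+[n∸m]≡n c≤w)) (cong (c +_) (sym (m≤n⇒∣n-m∣≡n∸m c≤w))))
... | inj₂ w≤c = inj₂ (trans (sym (m∸[m∸n]≡n w≤c)) (cong (c ∸_) (sym (m≤n⇒∣m-n∣≡n∸m w≤c))))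

∈-ball : ∀ c w t → length w ≡ length c → ℓ₁ w c ≤ t → w ∈ ball c t
∈-ball []       []       t _     _        = here refl
∈-ball (c ∷ cs) (w ∷ ws) t |w|≡|c| ℓ₁≤t =
  ∈-concatMap⁺ _ (lose (∈-upTo⁺ (s≤s (≤-trans (m≤m+n j (ℓ₁ ws cs)) ℓ₁≤t))) w∷ws∈prepend)
  where
  j = ∣ w - c ∣
  ws∈ball : ws ∈ ball cs (t ∸ j)
  ws∈ball = ∈-ball cs ws (t ∸ j) (suc-injective |w|≡|c|)
    (≤-trans (≤-reflexive (sym (m+n∸m≡n j (ℓ₁ ws cs)))) (∸-monoˡ-≤ j ℓ₁≤t))
  w∷ws∈prepend : w ∷ ws ∈ prepend± c j (ball cs (t ∸ j))
  w∷ws∈prepend with ≡+∣-∣⊎≡∸∣-∣ w c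
  ... | inj₁ w≡c+j = subst (λ v → v ∷ ws ∈ prepend± c j (ball cs (t ∸ j))) (sym w≡c+j)
                       (∈-++⁺ˡ (∈-map⁺ ((c + j) ∷_) ws∈ball))
  ... | inj₂ w≡c∸j = subst (λ v → v ∷ ws ∈ prepend± c j (ball cs (t ∸ j))) (sym w≡c∸j)
                       (∈-++⁺ʳ (map ((c + j) ∷_) (ball cs (t ∸ j))) (∈-map⁺ ((c ∸ j) ∷_) ws∈ball))

length-concatMap : ∀ (f : A → List B) xs → length (concatMap f xs) ≡ ∑[ x ← xs ] length (f x)
length-concatMap f []       = refl
length-concatMap f (x ∷ xs) = trans (length-++ (f x)) (cong (length (f x) +_) (length-concatMap f xs))

length-prepend± : ∀ c j ws → length (prepend± c j ws) ≡ 2 * length ws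
length-prepend± c j ws = begin
  length (map ((c + j) ∷_) ws ++ map ((c ∸ j) ∷_) ws)     ≡⟨ length-++ (map ((c + j) ∷_) ws) ⟩
  length (map ((c + j) ∷_) ws) + length (map ((c ∸ j) ∷_) ws) ≡⟨ cong₂ _+_ (length-map _ ws) (length-map _ ws) ⟩
  length ws + length ws                                   ≡⟨ cong (length ws +_) (sym (+-identityʳ (length ws))) ⟩
  2 * length ws                                           ∎
  where open ≡-Reasoning

length-ball-∷ : ∀ c cs t → length (ball (c ∷ cs) t) ≡ ∑[ j ← upTo (suc t) ] (2 * length (ball cs (t ∸ j)))
length-ball-∷ c cs t = trans (length-concatMap (λ j → prepend± c j (ball cs (t ∸ j))) (upTo (suc t)))
  (∑-cong (upTo (suc t)) (λ j → length-prepend± c j (ball cs (t ∸ j))))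

length-ball-weighted : ∀ a cs t → length (ball cs t) * a ^ t ≤ 2 ^ length cs * suc a ^ (t + length cs)
length-ball-weighted a []       t = subst (λ e → a ^ t + 0 ≤ suc a ^ e + 0) (sym (+-identityʳ t))
                                      (+-monoˡ-≤ 0 (^-monoˡ-≤ t (n≤1+n a)))
length-ball-weighted a (c ∷ cs) t = begin
  length (ball (c ∷ cs) t) * a ^ t                ≡⟨ cong (_* a ^ t) (length-ball-∷ c cs t) ⟩
  ∑[ j ← js ] (2 * L (t ∸ j)) * a ^ t             ≡⟨ sym (∑-*ʳ js (a ^ t) (λ j → 2 * L (t ∸ j))) ⟩
  ∑[ j ← js ] (2 * L (t ∸ j) * a ^ t)             ≤⟨ ∑-mono-≤ js (λ j j∈js → term-≤ j (∈-upTo⁻ j∈js)) ⟩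
  ∑[ j ← js ] (K * (a ^ j * suc a ^ (t ∸ j)))     ≡⟨ ∑-*ˡ js K _ ⟩
  K * ∑[ j ← js ] (a ^ j * suc a ^ (t ∸ j))       ≤⟨ *-monoʳ-≤ K (∑-geometric a t) ⟩
  K * suc a ^ suc t                               ≡⟨ regroup ⟩
  2 ^ suc m * suc a ^ (t + suc m)                 ∎
  where
  open ≤-Reasoning
  js = upTo (suc t)
  m = length cs
  L : ℕ → ℕ
  L u = length (ball cs u)
  K = 2 * 2 ^ m * suc a ^ m
  regroup : K * suc a ^ suc t ≡ 2 ^ suc m * suc a ^ (t + suc m)
  regroup = begin-equality
    2 * 2 ^ m * suc a ^ m * suc a ^ suc t   ≡⟨ *-assoc (2 * 2 ^ m) _ _ ⟩
    2 * 2 ^ m * (suc a ^ m * suc a ^ suc t) ≡⟨ cong (2 * 2 ^ m *_) (sym (^-distribˡ-+-* (suc a) m (suc t))) ⟩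
    2 * 2 ^ m * suc a ^ (m + suc t)         ≡⟨ cong (λ e → 2 * 2 ^ m * suc a ^ e) (+-comm m (suc t)) ⟩
    2 * 2 ^ m * suc a ^ (suc t + m)         ≡⟨ cong (λ e → 2 * 2 ^ m * suc a ^ e) (sym (+-suc t m)) ⟩
    2 ^ suc m * suc a ^ (t + suc m)         ∎
  term-≤ : ∀ j → j < suc t → 2 * L (t ∸ j) * a ^ t ≤ K * (a ^ j * suc a ^ (t ∸ j))
  term-≤ j j≤t = begin
    2 * L (t ∸ j) * a ^ t
      ≡⟨ cong (λ e → 2 * L (t ∸ j) * a ^ e) (sym (m∸n+n≡m (≤-pred j≤t))) ⟩
    2 * L (t ∸ j) * a ^ (t ∸ j + j)
      ≡⟨ cong (2 * L (t ∸ j) *_) (^-distribˡ-+-* a (t ∸ j) j) ⟩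
    2 * L (t ∸ j) * (a ^ (t ∸ j) * a ^ j)
      ≡⟨ reassoc 2 (L (t ∸ j)) (a ^ (t ∸ j)) (a ^ j) ⟩
    2 * (L (t ∸ j) * a ^ (t ∸ j)) * a ^ j
      ≤⟨ *-monoˡ-≤ (a ^ j) (*-monoʳ-≤ 2 (length-ball-weighted a cs (t ∸ j))) ⟩
    2 * (2 ^ m * suc a ^ (t ∸ j + m)) * a ^ j
      ≡⟨ cong (λ e → 2 * (2 ^ m * e) * a ^ j) (^-distribˡ-+-* (suc a) (t ∸ j) m) ⟩
    2 * (2 ^ m * (suc a ^ (t ∸ j) * suc a ^ m)) * a ^ j
      ≡⟨ reorder 2 (2 ^ m) (suc a ^ (t ∸ j)) (suc a ^ m) (a ^ j) ⟩
    K * (a ^ j * suc a ^ (t ∸ j))                       ∎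
    where
    reassoc : ∀ x y z w → x * y * (z * w) ≡ x * (y * z) * w
    reassoc = solve-∀
    reorder : ∀ x y z w v → x * (y * (z * w)) * v ≡ x * y * w * (v * z)
    reorder = solve-∀

length-ball : ∀ h cs → length (ball cs (suc h * length cs)) ≤ (8 * suc h) ^ length cs
length-ball h cs = *-cancelʳ-≤ (length (ball cs t)) ((8 * suc h) ^ m) (a ^ t) {{aᵗ≢0}} (begin
  length (ball cs t) * a ^ t           ≤⟨ length-ball-weighted a cs t ⟩
  2 ^ m * suc a ^ (t + m)              ≡⟨ cong (2 ^ m *_) (^-distribˡ-+-* (suc a) t m) ⟩
  2 ^ m * (suc a ^ t * suc a ^ m)      ≤⟨ *-monoʳ-≤ (2 ^ m) (*-monoˡ-≤ (suc a ^ m) [1+a]ᵗ≤2ᵐaᵗ) ⟩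
  2 ^ m * (2 ^ m * a ^ t * suc a ^ m)  ≡⟨ reorder (2 ^ m) (a ^ t) (suc a ^ m) ⟩
  (2 ^ m * 2 ^ m * suc a ^ m) * a ^ t  ≡⟨ cong (_* a ^ t) (sym (^-distrib³ 2 2 (suc a) m)) ⟩
  (2 * 2 * suc a) ^ m * a ^ t          ≡⟨ cong (λ x → x ^ m * a ^ t) (4[2+2h]≡8[1+h] h) ⟩
  (8 * suc h) ^ m * a ^ t              ∎)
  where
  open ≤-Reasoning
  m = length cs
  t = suc h * m
  a = suc (2 * h)
  ^-distrib³ : ∀ x y z m → (x * y * z) ^ m ≡ x ^ m * y ^ m * z ^ m
  ^-distrib³ x y z m = trans (^-distribʳ-* (x * y) z m) (cong (_* z ^ m) (^-distribʳ-* x y m))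
  reorder : ∀ x y z → x * (x * y * z) ≡ (x * x * z) * y
  reorder = solve-∀
  2[1+h]≡2+2h : ∀ h → 2 * suc h ≡ suc (suc (2 * h))
  2[1+h]≡2+2h = solve-∀
  4[2+2h]≡8[1+h] : ∀ h → 2 * 2 * suc (suc (2 * h)) ≡ 8 * suc h
  4[2+2h]≡8[1+h] = solve-∀
  aᵗ≢0 : NonZero (a ^ t)
  aᵗ≢0 = >-nonZero (m^n>0 a t)
  [1+a]ᵗ≤2ᵐaᵗ : suc a ^ t ≤ 2 ^ m * a ^ t
  [1+a]ᵗ≤2ᵐaᵗ = begin
    suc a ^ (suc h * m)        ≡⟨ sym (^-*-assoc (suc a) (suc h) m) ⟩
    (suc a ^ suc h) ^ m        ≤⟨ ^-monoˡ-≤ m ([1+a]^[1+k]≤2a^[1+k] a h (≤-reflexive (2[1+h]≡2+2h h))) ⟩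
    (2 * a ^ suc h) ^ m        ≡⟨ ^-distribʳ-* 2 (a ^ suc h) m ⟩
    2 ^ m * (a ^ suc h) ^ m    ≡⟨ cong (2 ^ m *_) (^-*-assoc a (suc h) m) ⟩
    2 ^ m * a ^ t              ∎

-- Variances of sums

-- V bounds (length xs)² times the variance of f over xs.
VarianceBound : List A → (A → ℕ) → ℕ → Set
VarianceBound xs f V = length xs * ∑[ x ← xs ] (f x * f x) ≤ ∑ xs f * ∑ xs f + V

VarianceBound-bounded : ∀ (xs : List A) f D → (∀ x → f x ≤ D) → VarianceBound xs f (length xs * length xs * (D * D))
VarianceBound-bounded xs f D f≤D = begin
  N * ∑[ x ← xs ] (f x * f x)       ≤⟨ *-monoʳ-≤ N (∑-mono-≤ xs (λ x _ → *-mono-≤ (f≤D x) (f≤D x))) ⟩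
  N * ∑[ _ ← xs ] (D * D)           ≡⟨ cong (N *_) (∑-const xs (D * D)) ⟩
  N * (N * (D * D))                 ≡⟨ sym (*-assoc N N (D * D)) ⟩
  N * N * (D * D)                   ≤⟨ m≤n+m _ (∑ xs f * ∑ xs f) ⟩
  ∑ xs f * ∑ xs f + N * N * (D * D) ∎
  where
  open ≤-Reasoning
  N = length xs

∑-linear : ∀ (xs : List A) a b c (f g : A → ℕ) →
  ∑[ x ← xs ] (a * f x + b * g x + c) ≡ a * ∑ xs f + b * ∑ xs g + length xs * c
∑-linear xs a b c f g = begin
  ∑[ x ← xs ] (a * f x + b * g x + c)
    ≡⟨ ∑-distrib-+ xs _ _ ⟩
  ∑[ x ← xs ] (a * f x + b * g x) + ∑[ _ ← xs ] c
    ≡⟨ cong₂ _+_ (∑-distrib-+ xs _ _) (∑-const xs c) ⟩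
  ∑[ x ← xs ] (a * f x) + ∑[ x ← xs ] (b * g x) + length xs * c
    ≡⟨ cong (_+ length xs * c) (cong₂ _+_ (∑-*ˡ xs a f) (∑-*ˡ xs b g)) ⟩
  a * ∑ xs f + b * ∑ xs g + length xs * c
    ∎
  where open ≡-Reasoning

module _ (xs : List A) (ys : List B) (f : A → ℕ) (g : B → ℕ) where

  ∑∑-+ : ∑[ x ← xs ] ∑[ y ← ys ] (f x + g y) ≡ length ys * ∑ xs f + length xs * ∑ ys g
  ∑∑-+ = begin
    ∑[ x ← xs ] ∑[ y ← ys ] (f x + g y)
      ≡⟨ ∑-cong xs (λ x → ∑-distrib-+ ys (λ _ → f x) g) ⟩
    ∑[ x ← xs ] (∑[ _ ← ys ] f x + ∑ ys g)
      ≡⟨ ∑-cong xs (λ x → cong (_+ ∑ ys g) (∑-const ys (f x))) ⟩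
    ∑[ x ← xs ] (length ys * f x + ∑ ys g)
      ≡⟨ ∑-distrib-+ xs _ _ ⟩
    ∑[ x ← xs ] (length ys * f x) + ∑[ _ ← xs ] ∑ ys g
      ≡⟨ cong₂ _+_ (∑-*ˡ xs (length ys) f) (∑-const xs (∑ ys g)) ⟩
    length ys * ∑ xs f + length xs * ∑ ys g
      ∎
    where open ≡-Reasoning

  ∑∑-+² : ∑[ x ← xs ] ∑[ y ← ys ] ((f x + g y) * (f x + g y))
        ≡ length ys * ∑[ x ← xs ] (f x * f x) + 2 * (∑ xs f * ∑ ys g) + length xs * ∑[ y ← ys ] (g y * g y)
  ∑∑-+² = begin
    ∑[ x ← xs ] ∑[ y ← ys ] ((f x + g y) * (f x + g y))
      ≡⟨ ∑-cong xs (λ x → trans (∑-cong ys (λ y → expand (f x) (g y)))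
                                 (∑-linear ys (2 * f x) 1 (f x * f x) g (λ y → g y * g y))) ⟩
    ∑[ x ← xs ] (2 * f x * G₁ + 1 * G₂ + length ys * (f x * f x))
      ≡⟨ ∑-cong xs (λ x → reorder (f x) G₁ G₂ (length ys)) ⟩
    ∑[ x ← xs ] (length ys * (f x * f x) + 2 * G₁ * f x + G₂)
      ≡⟨ ∑-linear xs (length ys) (2 * G₁) G₂ (λ x → f x * f x) f ⟩
    length ys * ∑[ x ← xs ] (f x * f x) + 2 * G₁ * ∑ xs f + length xs * G₂
      ≡⟨ cong (λ z → length ys * ∑[ x ← xs ] (f x * f x) + z + length xs * G₂) (swap G₁ (∑ xs f)) ⟩
    length ys * ∑[ x ← xs ] (f x * f x) + 2 * (∑ xs f * G₁) + length xs * G₂ ∎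
    where
    open ≡-Reasoning
    G₁ = ∑ ys g
    G₂ = ∑[ y ← ys ] (g y * g y)
    expand : ∀ a b → (a + b) * (a + b) ≡ 2 * a * b + 1 * (b * b) + a * a
    expand = solve-∀
    reorder : ∀ a G₁ G₂ n → 2 * a * G₁ + 1 * G₂ + n * (a * a) ≡ n * (a * a) + 2 * G₁ * a + G₂
    reorder = solve-∀
    swap : ∀ a b → 2 * a * b ≡ 2 * (b * a)
    swap = solve-∀

VarianceBound-cartesianProductWith :
  ∀ (h : A → B → C) (xs : List A) (ys : List B) (f : A → ℕ) (g : B → ℕ) (F : C → ℕ) U W →
  (∀ x y → F (h x y) ≡ f x + g y) → VarianceBound xs f U → VarianceBound ys g W →
  VarianceBound (cartesianProductWith h xs ys) F (length ys * length ys * U + length xs * length xs * W)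
VarianceBound-cartesianProductWith h xs ys f g F U W F≡f+g var-f var-g = begin
  length P * ∑[ z ← P ] (F z * F z)
    ≡⟨ cong₂ _*_ (length-cartesianProductWith h xs ys) ∑P²≡ ⟩
  n₁ * n₂ * (n₂ * F₂ + 2 * (F₁ * G₁) + n₁ * G₂)
    ≡⟨ expand n₁ n₂ F₁ F₂ G₁ G₂ ⟩
  n₂ * n₂ * (n₁ * F₂) + 2 * (n₁ * n₂ * F₁ * G₁) + n₁ * n₁ * (n₂ * G₂)
    ≤⟨ +-mono-≤ (+-monoˡ-≤ _ (*-monoʳ-≤ (n₂ * n₂) var-f)) (*-monoʳ-≤ (n₁ * n₁) var-g) ⟩
  n₂ * n₂ * (F₁ * F₁ + U) + 2 * (n₁ * n₂ * F₁ * G₁) + n₁ * n₁ * (G₁ * G₁ + W)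
    ≡⟨ collect n₁ n₂ F₁ G₁ U W ⟩
  (n₂ * F₁ + n₁ * G₁) * (n₂ * F₁ + n₁ * G₁) + (n₂ * n₂ * U + n₁ * n₁ * W)
    ≡⟨ cong (λ v → v * v + (n₂ * n₂ * U + n₁ * n₁ * W)) (sym ∑P≡) ⟩
  ∑ P F * ∑ P F + (n₂ * n₂ * U + n₁ * n₁ * W) ∎
  where
  open ≤-Reasoning
  P = cartesianProductWith h xs ys
  n₁ = length xs
  n₂ = length ys
  F₁ = ∑ xs f
  F₂ = ∑[ x ← xs ] (f x * f x)
  G₁ = ∑ ys g
  G₂ = ∑[ y ← ys ] (g y * g y)
  ∑P≡ : ∑ P F ≡ n₂ * F₁ + n₁ * G₁
  ∑P≡ = trans (∑-cartesianProductWith h xs ys F)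
    (trans (∑-cong xs (λ x → ∑-cong ys (F≡f+g x))) (∑∑-+ xs ys f g))
  ∑P²≡ : ∑[ z ← P ] (F z * F z) ≡ n₂ * F₂ + 2 * (F₁ * G₁) + n₁ * G₂
  ∑P²≡ = trans (∑-cartesianProductWith h xs ys (λ z → F z * F z))
    (trans (∑-cong xs (λ x → ∑-cong ys (λ y → cong (λ v → v * v) (F≡f+g x y)))) (∑∑-+² xs ys f g))
  expand : ∀ n₁ n₂ F₁ F₂ G₁ G₂ → n₁ * n₂ * (n₂ * F₂ + 2 * (F₁ * G₁) + n₁ * G₂)
         ≡ n₂ * n₂ * (n₁ * F₂) + 2 * (n₁ * n₂ * F₁ * G₁) + n₁ * n₁ * (n₂ * G₂)
  expand = solve-∀
  collect : ∀ n₁ n₂ F₁ G₁ U W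
          → n₂ * n₂ * (F₁ * F₁ + U) + 2 * (n₁ * n₂ * F₁ * G₁) + n₁ * n₁ * (G₁ * G₁ + W)
          ≡ (n₂ * F₁ + n₁ * G₁) * (n₂ * F₁ + n₁ * G₁) + (n₂ * n₂ * U + n₁ * n₁ * W)
  collect = solve-∀

length-allFin : ∀ q → length (allFin q) ≡ q
length-allFin q = length-tabulate id

allVecs : ∀ q n → List (Vec (Fin q) n)
allVecs q zero    = [] ∷ []
allVecs q (suc n) = cartesianProductWith _∷_ (allFin q) (allVecs q n)

length-allVecs : ∀ q n → length (allVecs q n) ≡ q ^ n
length-allVecs q zero    = refl
length-allVecs q (suc n) = trans (length-cartesianProductWith _∷_ (allFin q) (allVecs q n))
                                 (cong₂ _*_ (length-allFin q) (length-allVecs q n))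

allVecs⁺ : ∀ q n → Unique (allVecs q n)
allVecs⁺ q zero    = All.[] ∷ []
allVecs⁺ q (suc n) = cartesianProductWith⁺ _∷_ ∷-injective (allFin⁺ q) (allVecs⁺ q n)

sumDist : ∀ {q n} → (Fin q → Fin q → ℕ) → Vec (Fin q) n → Vec (Fin q) n → ℕ
sumDist g []      []      = 0
sumDist g (a ∷ s) (b ∷ x) = g a b + sumDist g s x

VarianceBound-sumDist : ∀ {q} (g : Fin q → Fin q → ℕ) D → (∀ a b → g a b ≤ D) → ∀ n (s : Vec (Fin q) n) →
  VarianceBound (allVecs q n) (sumDist g s) (length (allVecs q n) * length (allVecs q n) * (n * (D * D)))
VarianceBound-sumDist g D g≤D zero    []      = z≤n
VarianceBound-sumDist {q} g D g≤D (suc n) (a ∷ s) =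
  subst (VarianceBound (allVecs q (suc n)) (sumDist g (a ∷ s))) bound≡
    (VarianceBound-cartesianProductWith _∷_ (allFin q) (allVecs q n) (g a) (sumDist g s) (sumDist g (a ∷ s))
       _ _ (λ _ _ → refl) (VarianceBound-bounded (allFin q) (g a) D (g≤D a)) (VarianceBound-sumDist g D g≤D n s))
  where
  Q = length (allFin q)
  N = length (allVecs q n)
  regroup : ∀ Q N n D → N * N * (Q * Q * (D * D)) + Q * Q * (N * N * (n * (D * D))) ≡ Q * N * (Q * N) * (suc n * (D * D))
  regroup = solve-∀
  bound≡ : N * N * (Q * Q * (D * D)) + Q * Q * (N * N * (n * (D * D)))
         ≡ length (allVecs q (suc n)) * length (allVecs q (suc n)) * (suc n * (D * D))
  bound≡ = trans (regroup Q N n D)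
    (cong (λ L → L * L * (suc n * (D * D))) (sym (length-cartesianProductWith _∷_ (allFin q) (allVecs q n))))

∑∑-∣-∣²+2[∑]²≡2N∑² : ∀ (xs : List A) (f : A → ℕ) →
  ∑[ x ← xs ] ∑[ y ← xs ] (∣ f x - f y ∣ * ∣ f x - f y ∣) + 2 * (∑ xs f * ∑ xs f)
    ≡ 2 * (length xs * ∑[ x ← xs ] (f x * f x))
∑∑-∣-∣²+2[∑]²≡2N∑² {A = A} xs f = begin
  P + 2 * (∑ xs f * ∑ xs f)
    ≡⟨ cong (λ v → P + 2 * v) (sym (∑-*-∑ xs xs f f)) ⟩
  P + 2 * ∑[ x ← xs ] ∑[ y ← xs ] (f x * f y)
    ≡⟨ cong (P +_) (sym (∑-*ˡ xs 2 _)) ⟩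
  P + ∑[ x ← xs ] (2 * ∑[ y ← xs ] (f x * f y))
    ≡⟨ sym (∑-distrib-+ xs _ _) ⟩
  ∑[ x ← xs ] (∑[ y ← xs ] d² x y + 2 * ∑[ y ← xs ] (f x * f y))
    ≡⟨ ∑-cong xs (λ x → cong (∑[ y ← xs ] d² x y +_) (sym (∑-*ˡ xs 2 _))) ⟩
  ∑[ x ← xs ] (∑[ y ← xs ] d² x y + ∑[ y ← xs ] (2 * (f x * f y)))
    ≡⟨ ∑-cong xs (λ x → sym (∑-distrib-+ xs _ _)) ⟩
  ∑[ x ← xs ] ∑[ y ← xs ] (d² x y + 2 * (f x * f y))
    ≡⟨ ∑-cong xs (λ x → ∑-cong xs (λ y → polarise x y)) ⟩
  ∑[ x ← xs ] ∑[ y ← xs ] (f x * f x + f y * f y)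
    ≡⟨ ∑-cong xs (λ x → ∑-distrib-+ xs _ _) ⟩
  ∑[ x ← xs ] (∑[ _ ← xs ] (f x * f x) + S₂)
    ≡⟨ ∑-cong xs (λ x → cong (_+ S₂) (∑-const xs (f x * f x))) ⟩
  ∑[ x ← xs ] (length xs * (f x * f x) + S₂)
    ≡⟨ ∑-distrib-+ xs _ _ ⟩
  ∑[ x ← xs ] (length xs * (f x * f x)) + ∑[ _ ← xs ] S₂
    ≡⟨ cong₂ _+_ (∑-*ˡ xs (length xs) _) (∑-const xs S₂) ⟩
  length xs * S₂ + length xs * S₂
    ≡⟨ cong (length xs * S₂ +_) (sym (+-identityʳ _)) ⟩
  2 * (length xs * S₂)                                             ∎
  where
  open ≡-Reasoning
  d² : A → A → ℕ
  d² x y = ∣ f x - f y ∣ * ∣ f x - f y ∣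
  P = ∑[ x ← xs ] ∑[ y ← xs ] d² x y
  S₂ = ∑[ x ← xs ] (f x * f x)
  polarise : ∀ x y → d² x y + 2 * (f x * f y) ≡ f x * f x + f y * f y
  polarise x y = trans (+-comm (d² x y) _) (sym (m²+n²≡2mn+∣m-n∣² (f x) (f y)))

-- Cauchy–Schwarz twice turns the bound on Σ∣f x - f y∣² into one on Σ∣f x - f y∣.
∑∑-∣-∣-bound : ∀ (xs : List A) (f : A → ℕ) V ρ →
  VarianceBound xs f (length xs * length xs * V) → 2 * V ≤ ρ * ρ →
  ∑[ x ← xs ] ∑[ y ← xs ] ∣ f x - f y ∣ ≤ length xs * length xs * ρ
∑∑-∣-∣-bound {A = A} xs f V ρ var 2V≤ρ² = m*m≤n*n⇒m≤n (begin
  T * T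
    ≤⟨ cauchy-schwarz xs _ ⟩
  N * ∑[ x ← xs ] (∑[ y ← xs ] d x y * ∑[ y ← xs ] d x y)
    ≤⟨ *-monoʳ-≤ N (∑-mono-≤ xs (λ x _ → cauchy-schwarz xs (d x))) ⟩
  N * ∑[ x ← xs ] (N * ∑[ y ← xs ] (d x y * d x y))
    ≡⟨ cong (N *_) (∑-*ˡ xs N _) ⟩
  N * (N * P)
    ≤⟨ *-monoʳ-≤ N (*-monoʳ-≤ N P≤2N²V) ⟩
  N * (N * (N * N * (2 * V)))
    ≤⟨ *-monoʳ-≤ N (*-monoʳ-≤ N (*-monoʳ-≤ (N * N) 2V≤ρ²)) ⟩
  N * (N * (N * N * (ρ * ρ)))
    ≡⟨ square N ρ ⟩
  N * N * ρ * (N * N * ρ)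
    ∎)
  where
  open ≤-Reasoning
  N = length xs
  S₁ = ∑ xs f
  d : A → A → ℕ
  d x y = ∣ f x - f y ∣
  T = ∑[ x ← xs ] ∑[ y ← xs ] d x y
  P = ∑[ x ← xs ] ∑[ y ← xs ] (d x y * d x y)
  P≤2N²V : P ≤ N * N * (2 * V)
  P≤2N²V = +-cancelʳ-≤ (2 * (S₁ * S₁)) P (N * N * (2 * V)) (begin
    P + 2 * (S₁ * S₁)                      ≡⟨ ∑∑-∣-∣²+2[∑]²≡2N∑² xs f ⟩
    2 * (N * ∑[ x ← xs ] (f x * f x))      ≤⟨ *-monoʳ-≤ 2 var ⟩
    2 * (S₁ * S₁ + N * N * V)              ≡⟨ distribute (S₁ * S₁) (N * N) V ⟩
    N * N * (2 * V) + 2 * (S₁ * S₁)        ∎)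
    where
    distribute : ∀ a b V → 2 * (a + b * V) ≡ b * (2 * V) + 2 * a
    distribute = solve-∀
  square : ∀ N ρ → N * (N * (N * N * (ρ * ρ))) ≡ N * N * ρ * (N * N * ρ)
  square = solve-∀

-- Counting points by the spread of their profiles

markov : ∀ {P : A → Set} (P? : Decidable P) (d : A → ℕ) c → (∀ x → ¬ P x → c ≤ d x) → ∀ xs →
  length xs * c ≤ length (filter P? xs) * c + ∑ xs d
markov P? d c ¬P⇒c≤d []       = z≤n
markov P? d c ¬P⇒c≤d (x ∷ xs) with P? x | markov P? d c ¬P⇒c≤d xs
... | yes _  | ih = begin
  c + length xs * c           ≤⟨ +-monoʳ-≤ c ih ⟩
  c + (F * c + ∑ xs d)        ≡⟨ sym (+-assoc c (F * c) (∑ xs d)) ⟩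
  c + F * c + ∑ xs d          ≤⟨ +-monoʳ-≤ (c + F * c) (m≤n+m (∑ xs d) (d x)) ⟩
  c + F * c + (d x + ∑ xs d)  ∎
  where
  open ≤-Reasoning
  F = length (filter P? xs)
... | no ¬Px | ih = begin
  c + length xs * c           ≤⟨ +-mono-≤ (¬P⇒c≤d x ¬Px) ih ⟩
  d x + (F * c + ∑ xs d)      ≡⟨ x∙yz≈y∙xz (d x) (F * c) (∑ xs d) ⟩
  F * c + (d x + ∑ xs d)      ∎
  where
  open ≤-Reasoning
  F = length (filter P? xs)

averaging-cancel : ∀ N K t B → N * N * suc t ≤ N * K * suc t + B → 2 * B ≤ N * N * t → N ≤ 2 * K
averaging-cancel zero    K t B _ _ = z≤n
averaging-cancel N@(suc _) K t B markov-sum 2B≤N²t =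
  *-cancelʳ-≤ N (2 * K) N (*-cancelʳ-≤ (N * N) (2 * K * N) (suc t) (+-cancelˡ-≤ (N * N * t) _ _ (begin
    N * N * t + N * N * suc t                  ≤⟨ +-monoʳ-≤ (N * N * t) (m≤m+n (N * N * suc t) (N * N)) ⟩
    N * N * t + (N * N * suc t + N * N)        ≡⟨ double (N * N) t ⟩
    2 * (N * N * suc t)                        ≤⟨ *-monoʳ-≤ 2 markov-sum ⟩
    2 * (N * K * suc t + B)                    ≡⟨ *-distribˡ-+ 2 (N * K * suc t) B ⟩
    2 * (N * K * suc t) + 2 * B                ≤⟨ +-monoʳ-≤ (2 * (N * K * suc t)) 2B≤N²t ⟩
    2 * (N * K * suc t) + N * N * t            ≡⟨ reorder N K t ⟩
    N * N * t + 2 * K * N * suc t              ∎)))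
  where
  open ≤-Reasoning
  double : ∀ M t → M * t + (M * suc t + M) ≡ 2 * (M * suc t)
  double = solve-∀
  reorder : ∀ N K t → 2 * (N * K * suc t) + N * N * t ≡ N * N * t + 2 * K * N * suc t
  reorder = solve-∀

profile : {X : Set} → List X → (X → A → ℕ) → A → List ℕ
profile ss φ x = map (λ s → φ s x) ss

-- At most (8 (2ρ + 1))ᵐ profiles lie within ℓ₁-distance t = (2ρ + 1) m of a given one, and by
-- Markov's inequality at least half of all pairs of points have profiles that close.
length-≤-by-spread : ∀ {X : Set} (xs : List A) (ss : List X) (φ : X → A → ℕ) ρ → Unique xs →
  (∀ {x y} → profile ss φ x ≡ profile ss φ y → x ≡ y) →
  (∀ s → ∑[ x ← xs ] ∑[ y ← xs ] ∣ φ s x - φ s y ∣ ≤ length xs * length xs * ρ) →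
  length xs ≤ 2 * (8 * suc (2 * ρ)) ^ length ss
length-≤-by-spread {A = A} xs ss φ ρ uniq profile-injective spread =
  averaging-cancel N K t (m * (N * N * ρ)) (begin
    N * N * suc t
      ≡⟨ *-assoc N N (suc t) ⟩
    N * (N * suc t)
      ≡⟨ sym (∑-const xs (N * suc t)) ⟩
    ∑[ x ← xs ] (N * suc t)
      ≤⟨ ∑-mono-≤ xs (λ x _ → markov (λ y → dist x y ≤? t) (dist x) (suc t) (λ _ → ≰⇒>) xs) ⟩
    ∑[ x ← xs ] (length (close x) * suc t + ∑ xs (dist x))
      ≡⟨ ∑-distrib-+ xs _ _ ⟩
    ∑[ x ← xs ] (length (close x) * suc t) + ∑[ x ← xs ] ∑ xs (dist x)
      ≤⟨ +-mono-≤ (∑-mono-≤ xs (λ x _ → *-monoˡ-≤ (suc t) (close-bound x))) total-dist ⟩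
    ∑[ _ ← xs ] (K * suc t) + m * (N * N * ρ)
      ≡⟨ cong (_+ m * (N * N * ρ)) (trans (∑-const xs (K * suc t)) (sym (*-assoc N K (suc t)))) ⟩
    N * K * suc t + m * (N * N * ρ)                              ∎)
    2B≤N²t
  where
  open ≤-Reasoning
  N = length xs
  m = length ss
  t = suc (2 * ρ) * m
  K = (8 * suc (2 * ρ)) ^ m
  dist : A → A → ℕ
  dist x y = ℓ₁ (profile ss φ y) (profile ss φ x)
  close : A → List A
  close x = filter (λ y → dist x y ≤? t) xs
  2B≤N²t : 2 * (m * (N * N * ρ)) ≤ N * N * t
  2B≤N²t = ≤-trans (≤-reflexive (reorder m N ρ)) (*-monoʳ-≤ (N * N) (*-monoˡ-≤ m (n≤1+n (2 * ρ))))
    where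
    reorder : ∀ m N ρ → 2 * (m * (N * N * ρ)) ≡ N * N * (2 * ρ * m)
    reorder = solve-∀
  close-bound : ∀ x → length (close x) ≤ K
  close-bound x = begin
    length (close x)
      ≡⟨ sym (length-map (profile ss φ) (close x)) ⟩
    length (map (profile ss φ) (close x))
      ≤⟨ length-mono-⊆ (map⁺ profile-injective (filter⁺ (λ y → dist x y ≤? t) uniq)) close⊆ball ⟩
    length (ball (profile ss φ x) t)
      ≤⟨ subst (λ l → length (ball (profile ss φ x) (suc (2 * ρ) * l)) ≤ (8 * suc (2 * ρ)) ^ l)
               (length-map _ ss) (length-ball (2 * ρ) (profile ss φ x)) ⟩
    K                                          ∎
    where
    close⊆ball : map (profile ss φ) (close x) ⊆ ball (profile ss φ x) t
    close⊆ball z∈ with y , y∈close , refl ← ∈-map⁻ (profile ss φ) z∈ =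
      ∈-ball (profile ss φ x) (profile ss φ y) t (trans (length-map _ ss) (sym (length-map _ ss)))
        (proj₂ (∈-filter⁻ (λ y → dist x y ≤? t) {xs = xs} y∈close))
  total-dist : ∑[ x ← xs ] ∑ xs (dist x) ≤ m * (N * N * ρ)
  total-dist = begin
    ∑[ x ← xs ] ∑[ y ← xs ] dist x y
      ≡⟨ ∑-cong xs (λ x → ∑-cong xs (λ y → ℓ₁-map ss (λ s → φ s y) (λ s → φ s x))) ⟩
    ∑[ x ← xs ] ∑[ y ← xs ] ∑[ s ← ss ] ∣ φ s y - φ s x ∣
      ≡⟨ ∑-cong xs (λ x → ∑-comm xs ss _) ⟩
    ∑[ x ← xs ] ∑[ s ← ss ] ∑[ y ← xs ] ∣ φ s y - φ s x ∣
      ≡⟨ ∑-comm xs ss _ ⟩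
    ∑[ s ← ss ] ∑[ x ← xs ] ∑[ y ← xs ] ∣ φ s y - φ s x ∣
      ≡⟨ ∑-cong ss (λ s → ∑-comm xs xs _) ⟩
    ∑[ s ← ss ] ∑[ y ← xs ] ∑[ x ← xs ] ∣ φ s y - φ s x ∣
      ≤⟨ ∑-mono-≤ ss (λ s _ → spread s) ⟩
    ∑[ _ ← ss ] (N * N * ρ)
      ≡⟨ ∑-const ss _ ⟩
    m * (N * N * ρ)                                               ∎

-- Distances in Cartesian powers

module _ {V : Set} {E : V → V → Set} where

  _++ᵂ_ : ∀ {u v w k l} → Walk E u v k → Walk E v w l → Walk E u w (k + l)
  here       ++ᵂ q = q
  step e p   ++ᵂ q = step e (p ++ᵂ q)

  Dist-minimal : ∀ {u v d j} → Dist E u v d → Walk E u v j → d ≤ j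
  Dist-minimal {d = d} {j} (_ , no-shorter) w with d ≤? j
  ... | yes d≤j = d≤j
  ... | no  d≰j = contradiction w (no-shorter j (≰⇒> d≰j))

  Dist-unique : ∀ {u v d d′} → Dist E u v d → Dist E u v d′ → d ≡ d′
  Dist-unique dist dist′ = ≤-antisym (Dist-minimal dist (proj₁ dist′)) (Dist-minimal dist′ (proj₁ dist))

  -- Walk existence is not decidable, so a shortest walk exists only up to double negation.
  ¬¬-Dist : ∀ {u v} L → Walk E u v L → ¬ ¬ (∃[ d ] Dist E u v d)
  ¬¬-Dist {u} {v} = <-rec (λ L → Walk E u v L → ¬ ¬ (∃[ d ] Dist E u v d)) shortest
    where
    shortest : ∀ L → (∀ {j} → j < L → Walk E u v j → ¬ ¬ (∃[ d ] Dist E u v d)) →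
               Walk E u v L → ¬ ¬ (∃[ d ] Dist E u v d)
    shortest L shorter w no-dist = ¬¬-excluded-middle {A = ∃[ j ] j < L × Walk E u v j} λ where
      (yes (j , j<L , wj)) → shorter j<L wj no-dist
      (no no-shorter)      → no-dist (L , w , λ j j<L wj → no-shorter (j , j<L , wj))

¬¬-Π-Fin : ∀ n {P : Fin n → Set} → (∀ i → ¬ ¬ P i) → ¬ ¬ (∀ i → P i)
¬¬-Π-Fin zero    ¬¬P ¬∀P = ¬∀P (λ ())
¬¬-Π-Fin (suc n) ¬¬P ¬∀P = ¬¬P zero λ P0 → ¬¬-Π-Fin n (λ i → ¬¬P (suc i)) λ P-suc →
  ¬∀P λ { zero → P0 ; (suc i) → P-suc i }

¬¬-distance : ∀ {q} (G : Graph q) → Connected G →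
  ¬ ¬ (Σ (Fin q → Fin q → ℕ) λ d → ∀ u v → Dist (Adj G) u v (d u v))
¬¬-distance {q} G connected = ¬¬-map (λ dist → (λ u v → proj₁ (dist u v)) , λ u v → proj₂ (dist u v))
  (¬¬-Π-Fin q λ u → ¬¬-Π-Fin q λ v → ¬¬-Dist _ (proj₂ (connected u v)))

map-≡⇒∈-≡ : ∀ {f g : A → B} (xs : List A) {x} → map f xs ≡ map g xs → x ∈ xs → f x ≡ g x
map-≡⇒∈-≡ (_ ∷ _)  fxs≡gxs (here refl)  = ∷-injectiveˡ fxs≡gxs
map-≡⇒∈-≡ (_ ∷ xs) fxs≡gxs (there x∈xs) = map-≡⇒∈-≡ xs (∷-injectiveʳ fxs≡gxs) x∈xs

module _ {q} (G : Graph q) (d : Fin q → Fin q → ℕ) (isDist : ∀ u v → Dist (Adj G) u v (d u v)) where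

  private
    Walk□ : ∀ {n} → Vec (Fin q) n → Vec (Fin q) n → ℕ → Set
    Walk□ {n} = Walk (PowAdj G n)

  lift-head : ∀ {n a b k} (s : Vec (Fin q) n) → Walk (Adj G) a b k → Walk□ (a ∷ s) (b ∷ s) k
  lift-head s here       = here
  lift-head s (step e w) = step (zero , e , λ { zero 0≢0 → contradiction refl 0≢0 ; (suc i) _ → refl }) (lift-head s w)

  lift-tail : ∀ {n s x k} (b : Fin q) → Walk□ {n} s x k → Walk□ (b ∷ s) (b ∷ x) k
  lift-tail b here                   = here
  lift-tail b (step (j , e , same) w) =
    step (suc j , e , λ { zero _ → refl ; (suc i) i≢j → same i (λ i≡j → i≢j (cong suc i≡j)) }) (lift-tail b w)

  walk-sumDist : ∀ {n} (s x : Vec (Fin q) n) → Walk□ s x (sumDist d s x)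
  walk-sumDist []      []      = here
  walk-sumDist (a ∷ s) (b ∷ x) = lift-head s (proj₁ (isDist a b)) ++ᵂ lift-tail b (walk-sumDist s x)

  d-step : ∀ a {v w} → Adj G v w → d a w ≤ d a v + 1
  d-step a {v} e = Dist-minimal (isDist a _) (proj₁ (isDist a v) ++ᵂ step e here)

  sumDist-step : ∀ {n} (s u w : Vec (Fin q) n) → PowAdj G n u w → sumDist d s w ≤ sumDist d s u + 1
  sumDist-step (a ∷ s) (u₀ ∷ u) (w₀ ∷ w) (zero , e , same) = begin
    d a w₀ + sumDist d s w       ≡⟨ cong (λ x → d a w₀ + sumDist d s x) (sym u≡w) ⟩
    d a w₀ + sumDist d s u       ≤⟨ +-monoˡ-≤ (sumDist d s u) (d-step a e) ⟩
    d a u₀ + 1 + sumDist d s u   ≡⟨ xy∙z≈xz∙y (d a u₀) 1 (sumDist d s u) ⟩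
    d a u₀ + sumDist d s u + 1   ∎
    where
    open ≤-Reasoning
    u≡w : u ≡ w
    u≡w = trans (sym (tabulate∘lookup u)) (trans (tabulate-cong (λ i → same (suc i) λ ())) (tabulate∘lookup w))
  sumDist-step (a ∷ s) (u₀ ∷ u) (w₀ ∷ w) (suc j , e , same) = begin
    d a w₀ + sumDist d s w
      ≡⟨ cong (λ x → d a x + sumDist d s w) (sym (same zero λ ())) ⟩
    d a u₀ + sumDist d s w
      ≤⟨ +-monoʳ-≤ (d a u₀) (sumDist-step s u w (j , e , λ i i≢j → same (suc i) (λ { refl → i≢j refl }))) ⟩
    d a u₀ + (sumDist d s u + 1)
      ≡⟨ sym (+-assoc (d a u₀) (sumDist d s u) 1) ⟩
    d a u₀ + sumDist d s u + 1   ∎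
    where open ≤-Reasoning

  sumDist-walk : ∀ {n} (s u v : Vec (Fin q) n) {j} → Walk□ u v j → sumDist d s v ≤ sumDist d s u + j
  sumDist-walk s u .u here = m≤m+n (sumDist d s u) 0
  sumDist-walk s u v {suc j} (step {w = w} e p) = begin
    sumDist d s v                ≤⟨ sumDist-walk s w v p ⟩
    sumDist d s w + j            ≤⟨ +-monoˡ-≤ j (sumDist-step s u w e) ⟩
    sumDist d s u + 1 + j        ≡⟨ +-assoc (sumDist d s u) 1 j ⟩
    sumDist d s u + suc j        ∎
    where open ≤-Reasoning

  sumDist-self : ∀ {n} (s : Vec (Fin q) n) → sumDist d s s ≡ 0
  sumDist-self []      = refl
  sumDist-self (a ∷ s) = cong₂ _+_ (n≤0⇒n≡0 (Dist-minimal (isDist a a) here)) (sumDist-self s)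

  Dist-sumDist : ∀ {n} (s x : Vec (Fin q) n) → Dist (PowAdj G n) s x (sumDist d s x)
  Dist-sumDist s x = walk-sumDist s x , λ j j< w →
    <⇒≱ j< (subst (λ z → sumDist d s x ≤ z + j) (sumDist-self s) (sumDist-walk s s x w))

  Resolves⇒profile-injective : ∀ {n} (S : List (Vec (Fin q) n)) → Resolves (PowAdj G n) S →
    ∀ {x y} → profile S (sumDist d) x ≡ profile S (sumDist d) y → x ≡ y
  Resolves⇒profile-injective S resolves {x} {y} same-profile = resolves x y λ s s∈S k →
      (λ dist-x → subst (Dist (PowAdj G _) s y) (trans (sym (same s∈S)) (Dist-unique (Dist-sumDist s x) dist-x))
                        (Dist-sumDist s y))
    , (λ dist-y → subst (Dist (PowAdj G _) s x) (trans (same s∈S) (Dist-unique (Dist-sumDist s y) dist-y))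
                        (Dist-sumDist s x))
    where
    same : ∀ {s} → s ∈ S → sumDist d s x ≡ sumDist d s y
    same = map-≡⇒∈-≡ S same-profile

landmark-bound : ∀ {q} (G : Graph q) (d : Fin q → Fin q → ℕ) → (∀ u v → Dist (Adj G) u v (d u v)) →
  ∀ D → (∀ u v → d u v ≤ D) → ∀ n (S : List (Vec (Fin q) n)) → Resolves (PowAdj G n) S →
  ∀ r → 2 * n ≤ r * r → q ^ n ≤ 2 * (8 * suc (2 * (D * r))) ^ length S
landmark-bound {q} G d isDist D d≤D n S resolves r 2n≤r² =
  subst (_≤ 2 * (8 * suc (2 * (D * r))) ^ length S) (length-allVecs q n)
    (length-≤-by-spread (allVecs q n) S (sumDist d) (D * r) (allVecs⁺ q n)
      (Resolves⇒profile-injective G d isDist S resolves)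
      (λ s → ∑∑-∣-∣-bound (allVecs q n) (sumDist d s) (n * (D * D)) (D * r)
               (VarianceBound-sumDist d D d≤D n s) 2nD²≤[Dr]²))
  where
  open ≤-Reasoning
  2nD²≤[Dr]² : 2 * (n * (D * D)) ≤ D * r * (D * r)
  2nD²≤[Dr]² = begin
    2 * (n * (D * D))   ≡⟨ sym (*-assoc 2 n (D * D)) ⟩
    2 * n * (D * D)     ≤⟨ *-monoˡ-≤ (D * D) 2n≤r² ⟩
    r * r * (D * D)     ≡⟨ reorder r D ⟩
    D * r * (D * r)     ∎
    where
    reorder : ∀ r D → r * r * (D * D) ≡ D * r * (D * r)
    reorder = solve-∀

exponent-bound : ∀ {q n m k D r} → 2 ≤ q → 1 ≤ D → 1 ≤ r → r * r ≤ 8 * n → n < q ^ suc k →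
  q ^ n ≤ 2 * (8 * suc (2 * (D * r))) ^ m → 2 * n ≤ m * k + 2 + (4608 * (D * D) + 1) * m
exponent-bound {q} {n} {m} {k} {D} {r} 2≤q 1≤D 1≤r r²≤8n n<qᵏ⁺¹ qⁿ≤2Hᵐ =
  ≤-trans (≤-reflexive (double n)) (≤-trans (≤-pred (^-cancelˡ-< q 2≤q q²ⁿ<q^e)) (≤-reflexive (regroup m k K)))
  where
  open ≤-Reasoning
  K = 4608 * (D * D)
  H = 8 * suc (2 * (D * r))
  double : ∀ n → 2 * n ≡ n + n
  double = solve-∀
  regroup : ∀ m k K → 2 + (K + suc k) * m ≡ m * k + 2 + (K + 1) * m
  regroup = solve-∀
  H≤24Dr : H ≤ 24 * (D * r)
  H≤24Dr = begin
    8 * (1 + 2 * (D * r))      ≤⟨ *-monoʳ-≤ 8 (+-monoˡ-≤ (2 * (D * r)) (*-mono-≤ 1≤D 1≤r)) ⟩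
    8 * (D * r + 2 * (D * r))  ≡⟨ triple (D * r) ⟩
    24 * (D * r)               ∎
    where
    triple : ∀ x → 8 * (x + 2 * x) ≡ 24 * x
    triple = solve-∀
  H²≤Kn : H * H ≤ K * n
  H²≤Kn = begin
    H * H                                ≤⟨ *-mono-≤ H≤24Dr H≤24Dr ⟩
    24 * (D * r) * (24 * (D * r))        ≡⟨ reorder D r ⟩
    576 * (D * D) * (r * r)              ≤⟨ *-monoʳ-≤ (576 * (D * D)) r²≤8n ⟩
    576 * (D * D) * (8 * n)              ≡⟨ reorder′ D n ⟩
    K * n                                ∎
    where
    reorder : ∀ D r → 24 * (D * r) * (24 * (D * r)) ≡ 576 * (D * D) * (r * r)
    reorder = solve-∀
    reorder′ : ∀ D n → 576 * (D * D) * (8 * n) ≡ 4608 * (D * D) * n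
    reorder′ = solve-∀
  Kn≤q^[K+k+1] : K * n ≤ q ^ (K + suc k)
  Kn≤q^[K+k+1] = begin
    K * n                ≤⟨ *-mono-≤ (≤-trans (<⇒≤ (n<2^n K)) (^-monoˡ-≤ K 2≤q)) (<⇒≤ n<qᵏ⁺¹) ⟩
    q ^ K * q ^ suc k    ≡⟨ sym (^-distribˡ-+-* q K (suc k)) ⟩
    q ^ (K + suc k)      ∎
  H²≤q^[K+k+1] : H * H ≤ q ^ (K + suc k)
  H²≤q^[K+k+1] = ≤-trans H²≤Kn Kn≤q^[K+k+1]
  q²ⁿ<q^e : q ^ (n + n) < q ^ suc (2 + (K + suc k) * m)
  q²ⁿ<q^e = begin-strict
    q ^ (n + n)                         ≡⟨ ^-distribˡ-+-* q n n ⟩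
    q ^ n * q ^ n                       ≤⟨ *-mono-≤ qⁿ≤2Hᵐ qⁿ≤2Hᵐ ⟩
    2 * H ^ m * (2 * H ^ m)             ≡⟨ reorder (H ^ m) ⟩
    4 * (H ^ m * H ^ m)                 ≡⟨ cong (4 *_) (sym (^-distribʳ-* H H m)) ⟩
    4 * (H * H) ^ m                     ≤⟨ *-mono-≤ (*-mono-≤ 2≤q 2≤q) (^-monoˡ-≤ m H²≤q^[K+k+1]) ⟩
    q * q * (q ^ (K + suc k)) ^ m       ≡⟨ cong₂ _*_ (cong (q *_) (sym (*-identityʳ q))) (^-*-assoc q (K + suc k) m) ⟩
    q ^ 2 * q ^ ((K + suc k) * m)       ≡⟨ sym (^-distribˡ-+-* q 2 ((K + suc k) * m)) ⟩
    q ^ (2 + (K + suc k) * m)           <⟨ ^-monoʳ-< q 2≤q (n<1+n (2 + (K + suc k) * m)) ⟩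
    q ^ suc (2 + (K + suc k) * m)       ∎
    where
    reorder : ∀ x → 2 * x * (2 * x) ≡ 4 * (x * x)
    reorder = solve-∀

FloorLog-≥ : ∀ {b n k j} → 2 ≤ b → b ^ j ≤ n → FloorLog b n k → j ≤ k
FloorLog-≥ {b} 2≤b bʲ≤n (_ , n<bᵏ⁺¹) = ≤-pred (^-cancelˡ-< b 2≤b (≤-<-trans bʲ≤n n<bᵏ⁺¹))

FloorLog₂-≤ : ∀ {n ℓ} → FloorLog 2 n ℓ → ℓ ≤ n
FloorLog₂-≤ {ℓ = ℓ} (2ˡ≤n , _) = <⇒≤ (<-≤-trans (n<2^n ℓ) 2ˡ≤n)

FloorLog₂-<-FloorLog : ∀ {q n k ℓ} → 2 ≤ q → FloorLog q n k → FloorLog 2 n ℓ → ℓ < q * suc k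
FloorLog₂-<-FloorLog {q} {n} {k} {ℓ} 2≤q (_ , n<qᵏ⁺¹) (2ˡ≤n , _) = ^-cancelˡ-< 2 ≤-refl (begin-strict
  2 ^ ℓ               ≤⟨ 2ˡ≤n ⟩
  n                   <⟨ n<qᵏ⁺¹ ⟩
  q ^ suc k           ≤⟨ ^-monoˡ-≤ (suc k) (<⇒≤ (n<2^n q)) ⟩
  (2 ^ q) ^ suc k     ≡⟨ ^-*-assoc 2 q (suc k) ⟩
  2 ^ (q * suc k)     ∎)
  where open ≤-Reasoning

-- When m k < 2 n, also m ℓ = O(n), so the error term γ m ℓ is absorbed into C n.
log-bound : ∀ {q n m k ℓ λ′} γ → 2 ≤ q → q ≤ n → 4 ≤ n →
  FloorLog q n k → FloorLog 2 n ℓ → FloorLog 2 ℓ λ′ → 2 * n ≤ m * k + 2 + γ * m →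
  2 * n * ℓ ≤ m * k * ℓ + (2 + 4 * q * γ) * n * λ′
log-bound {q} {n} {m} {k} {ℓ} {λ′} γ 2≤q q≤n 4≤n log-k log-ℓ log-λ 2n≤mk+2+γm with 2 * n ≤? m * k
... | yes 2n≤mk = ≤-trans (*-monoˡ-≤ ℓ 2n≤mk) (m≤m+n (m * k * ℓ) _)
... | no  2n≰mk = begin
  2 * n * ℓ
    ≤⟨ *-monoˡ-≤ ℓ 2n≤mk+2+γm ⟩
  (m * k + 2 + γ * m) * ℓ
    ≡⟨ distribute m k γ ℓ ⟩
  m * k * ℓ + (2 * ℓ + γ * (m * ℓ))
    ≤⟨ +-monoʳ-≤ (m * k * ℓ) (+-mono-≤ (*-monoʳ-≤ 2 ℓ≤n) (*-monoʳ-≤ γ mℓ≤4qn)) ⟩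
  m * k * ℓ + (2 * n + γ * (4 * q * n))
    ≡⟨ cong (m * k * ℓ +_) (collect n γ q) ⟩
  m * k * ℓ + (2 + 4 * q * γ) * n * 1
    ≤⟨ +-monoʳ-≤ (m * k * ℓ) (*-monoʳ-≤ ((2 + 4 * q * γ) * n) 1≤λ) ⟩
  m * k * ℓ + (2 + 4 * q * γ) * n * λ′      ∎
  where
  open ≤-Reasoning
  ℓ≤n : ℓ ≤ n
  ℓ≤n = FloorLog₂-≤ {n} {ℓ} log-ℓ
  1≤k : 1 ≤ k
  1≤k = FloorLog-≥ 2≤q (≤-trans (≤-reflexive (*-identityʳ q)) q≤n) log-k
  1≤λ : 1 ≤ λ′
  1≤λ = FloorLog-≥ {j = 1} ≤-refl (FloorLog-≥ {j = 2} ≤-refl 4≤n log-ℓ) log-λ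
  mℓ≤4qn : m * ℓ ≤ 4 * q * n
  mℓ≤4qn = begin
    m * ℓ                  ≤⟨ *-monoʳ-≤ m (<⇒≤ (FloorLog₂-<-FloorLog 2≤q log-k log-ℓ)) ⟩
    m * (q * suc k)        ≤⟨ *-monoʳ-≤ m (*-monoʳ-≤ q (+-monoˡ-≤ k 1≤k)) ⟩
    m * (q * (k + k))      ≡⟨ reorder m q k ⟩
    2 * q * (m * k)        ≤⟨ *-monoʳ-≤ (2 * q) (<⇒≤ (≰⇒> 2n≰mk)) ⟩
    2 * q * (2 * n)        ≡⟨ reorder′ q n ⟩
    4 * q * n              ∎
    where
    reorder : ∀ m q k → m * (q * (k + k)) ≡ 2 * q * (m * k)
    reorder = solve-∀
    reorder′ : ∀ q n → 2 * q * (2 * n) ≡ 4 * q * n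
    reorder′ = solve-∀
  distribute : ∀ m k γ ℓ → (m * k + 2 + γ * m) * ℓ ≡ m * k * ℓ + (2 * ℓ + γ * (m * ℓ))
  distribute = solve-∀
  collect : ∀ n γ q → 2 * n + γ * (4 * q * n) ≡ (2 + 4 * q * γ) * n * 1
  collect = solve-∀

square-bracket : ∀ M → ∃[ r ] M ≤ r * r × r * r ≤ 4 * M
square-bracket zero = 0 , z≤n , z≤n
square-bracket (suc M) with square-bracket M
... | r , M≤r² , r²≤4M with suc M ≤? r * r
...   | yes 1+M≤r² = r , 1+M≤r² , ≤-trans r²≤4M (*-monoʳ-≤ 4 (n≤1+n M))
...   | no  1+M≰r² = suc r , ≤-trans (s≤s (m≤m+n M (2 * r))) (≤-reflexive (sym [1+r]²≡)) , [1+r]²≤4[1+M]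
  where
  open ≤-Reasoning
  r²≡M : r * r ≡ M
  r²≡M = ≤-antisym (≤-pred (≰⇒> 1+M≰r²)) M≤r²
  [1+r]²≡ : suc r * suc r ≡ suc (M + 2 * r)
  [1+r]²≡ = trans (expand r) (cong (λ x → suc (x + 2 * r)) r²≡M)
    where
    expand : ∀ r → suc r * suc r ≡ suc (r * r + 2 * r)
    expand = solve-∀
  r≤M : r ≤ M
  r≤M = ≤-trans (m≤m*m r) (≤-reflexive r²≡M)
    where
    m≤m*m : ∀ m → m ≤ m * m
    m≤m*m zero        = z≤n
    m≤m*m m@(suc _)   = m≤m*n m m
  [1+r]²≤4[1+M] : suc r * suc r ≤ 4 * suc M
  [1+r]²≤4[1+M] = begin
    suc r * suc r         ≡⟨ [1+r]²≡ ⟩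
    suc (M + 2 * r)       ≤⟨ s≤s (+-monoʳ-≤ M (*-monoʳ-≤ 2 r≤M)) ⟩
    suc (M + 2 * M)       ≤⟨ m≤m+n _ (M + 3) ⟩
    suc (M + 2 * M) + (M + 3) ≡⟨ collect M ⟩
    4 * suc M             ∎
    where
    collect : ∀ M → suc (M + 2 * M) + (M + 3) ≡ 4 * suc M
    collect = solve-∀

resolving-set-bound : ∀ {q} (G : Graph q) (d : Fin q → Fin q → ℕ) → (∀ u v → Dist (Adj G) u v (d u v)) →
  ∀ D → 1 ≤ D → (∀ u v → d u v ≤ D) → 2 ≤ q → ∀ {n k ℓ λ′} → q + 4 ≤ n →
  FloorLog q n k → FloorLog 2 n ℓ → FloorLog 2 ℓ λ′ → ∀ (S : List (Vec (Fin q) n)) → Resolves (PowAdj G n) S →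
  2 * n * ℓ ≤ length S * k * ℓ + (2 + 4 * q * (4608 * (D * D) + 1)) * n * λ′
resolving-set-bound {q} G d isDist D 1≤D d≤D 2≤q {n} {k} q+4≤n log-k log-ℓ log-λ S resolves
  with r , 2n≤r² , r²≤8n ← square-bracket (2 * n) =
  log-bound {m = length S} {k = k} (4608 * (D * D) + 1) 2≤q (≤-trans (m≤m+n q 4) q+4≤n) 4≤n log-k log-ℓ log-λ
    (exponent-bound {m = length S} {k = k} 2≤q 1≤D 1≤r r²≤8n′ (proj₂ log-k)
      (landmark-bound G d isDist D d≤D n S resolves r 2n≤r²))
  where
  4≤n : 4 ≤ n
  4≤n = ≤-trans (m≤n+m 4 q) q+4≤n
  r²≤8n′ : r * r ≤ 8 * n
  r²≤8n′ = ≤-trans r²≤8n (≤-reflexive (sym (*-assoc 4 2 n)))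
  1≤r : 1 ≤ r
  1≤r = 1≤m*m⇒1≤m r (≤-trans (≤-trans (≤-trans (s≤s z≤n) 4≤n) (m≤m+n n (n + 0))) 2n≤r²)
    where
    1≤m*m⇒1≤m : ∀ m → 1 ≤ m * m → 1 ≤ m
    1≤m*m⇒1≤m (suc _) _ = s≤s z≤n

theorem3p1 : ∀ (q : ℕ) → 2 ≤ q → (G : Graph q) → Connected G →
    ∃₂ λ (C N : ℕ) → ∀ (n : ℕ) → N ≤ n →
    ∀ (k ℓ λ' : ℕ) → FloorLog q n k → FloorLog 2 n ℓ → FloorLog 2 ℓ λ' →
    ∀ (m : ℕ) → IsMetricDimension (PowAdj G n) m →
    2 * n * ℓ ≤ m * k * ℓ + C * n * λ'
theorem3p1 q 2≤q G connected = 2 + 4 * q * (4608 * (D * D) + 1) , q + 4 ,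
  λ { n q+4≤n k ℓ λ′ log-k log-ℓ log-λ m ((S , _ , resolves , refl) , _) →
      decidable-stable (_ ≤? _) (¬¬-map
        (λ (d , isDist) → resolving-set-bound G d isDist D (s≤s z≤n) (d≤D d isDist) 2≤q q+4≤n
                            log-k log-ℓ log-λ S resolves)
        (¬¬-distance G connected)) }
  where
  walk-length : Fin q → Fin q → ℕ
  walk-length u v = proj₁ (connected u v)
  D : ℕ
  D = suc (∑[ u ← allFin q ] ∑[ v ← allFin q ] walk-length u v)
  d≤D : ∀ d → (∀ u v → Dist (Adj G) u v (d u v)) → ∀ u v → d u v ≤ D
  d≤D d isDist u v = m≤n⇒m≤1+n (begin
    d u v                     ≤⟨ Dist-minimal (isDist u v) (proj₂ (connected u v)) ⟩
    walk-length u v           ≤⟨ ∈⇒≤∑ (walk-length u) (∈-allFin v) ⟩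
    row u                     ≤⟨ ∈⇒≤∑ row (∈-allFin u) ⟩
    ∑[ u ← allFin q ] row u   ∎)
    where
    open ≤-Reasoning
    row : Fin q → ℕ
    row u = ∑[ v ← allFin q ] walk-length u v
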